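{- For each integer $k\ge 1$, there is a graph with line-width at most $k$ and with wo-width at least $2k$.
   Context: A line is a nonempty set $L$ with a linear order $\le_L$. A line-decomposition of a graph $G$ is a pair $(L,(W_t:t\in L))$ where $L$ is a line and each $W_t\subseteq V(G)$, such that $G=\bigcup_{t\in L}G[W_t]$ and $W_t\cap W_{t''}\subseteq W_{t'}$ whenever $t\le_L t'\le_L t''$. Its width is the maximum of $|W_t|-1$ over $t\in L$ if it exists, and $\infty$ otherwise. The line-width of $G$ is the minimum width of a line-decomposition of $G$. A line $L$ is a well-order if there is no infinite sequence $t_1,t_2,\dots$ of distinct elements with $t_{i+1}\le_L t_i$ for all $i$. A wo-decomposition is a line-decomposition $(L,(W_t:t\in L))$ with $L$ a well-order, and the wo-width of $G$ is the minimum width of a wo-decomposition of $G$. -}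

module Defs where

open import Data.Nat using (ℕ; suc; _≤_)
open import Data.Product using (Σ; ∃; _×_)
open import Data.List using (List; length)
open import Data.List.Membership.Propositional using (_∈_)
open import Data.Empty using (⊥)
open import Relation.Nullary using (¬_)
open import Relation.Binary.PropositionalEquality using (_≡_)
open import Relation.Binary.Structures using (IsTotalOrder)
open import Function.Definitions using (Injective)

record Graph : Set₁ where
  field
    V     : Set
    E     : V → V → Set
    E-sym : ∀ {u v} → E u v → E v u
    E-irr : ∀ {v} → ¬ E v v

record Line : Set₁ where
  field
    Carrier      : Set
    _≤L_         : Carrier → Carrier → Set
    isTotalOrder : IsTotalOrder _≡_ _≤L_
    point        : Carrier

IsWellOrder : Line → Set
IsWellOrder L =
  ¬ (Σ (ℕ → Carrier) λ f → Injective _≡_ _≡_ f × (∀ i → f (suc i) ≤L f i))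
  where open Line L

-- A subset of A (given as a predicate) has at most n elements:
-- it is covered by a list of length at most n.
AtMost : {A : Set} → ℕ → (A → Set) → Set
AtMost {A} n W = Σ (List A) λ xs → length xs ≤ n × (∀ a → W a → a ∈ xs)

record LineDecomposition (G : Graph) : Set₁ where
  open Graph G
  field
    L : Line
  open Line L
  field
    W      : Carrier → V → Set
    vcover : ∀ v → ∃ λ t → W t v
    ecover : ∀ u v → E u v → ∃ λ t → W t u × W t v
    interp : ∀ t t' t'' → t ≤L t' → t' ≤L t'' → ∀ v → W t v → W t'' v → W t' v

module _ {G : Graph} where
  open LineDecomposition

  BagsAtMost : LineDecomposition G → ℕ → Set
  BagsAtMost D n = ∀ t → AtMost n (W D t)

  -- width ≤ k  ⇔  every bag has at most k+1 elements
  WidthAtMost : LineDecomposition G → ℕ → Set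
  WidthAtMost D k = BagsAtMost D (suc k)

  -- width ≥ m (for m ≥ 1, width possibly ∞)  ⇔  not every bag has at most m elements
  -- (i.e. not width ≤ m-1)
  WidthAtLeast : LineDecomposition G → ℕ → Set
  WidthAtLeast D m = ¬ BagsAtMost D m

LineWidthAtMost : Graph → ℕ → Set₁
LineWidthAtMost G k = Σ (LineDecomposition G) λ D → WidthAtMost D k

WoWidthAtLeast : Graph → ℕ → Set₁
WoWidthAtLeast G m =
  (D : LineDecomposition G) → IsWellOrder (LineDecomposition.L D) → WidthAtLeast D m

{-# OPTIONS --safe #-}
module Submission where

-- The graph is a chain of cliques: column a ∈ ℤ is a clique on {a} × {0..k},
-- and consecutive columns are joined by the k disjoint rungs (a, r+1) — (a+1, r).
-- In the lexicographic order, the windows from (a, s) up to (a+1, s) are bags of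
-- size k+1 of a line-decomposition.  Conversely, in any line-decomposition each
-- column lies in a bag t_a (Helly property of intervals).  If bags have at most
-- 2k vertices, then for b ∉ {c, c+1} the bag t_b misses a whole rung between
-- columns c and c+1, and this rung keeps t_b from lying between t_c and t_(c+1).
-- So t_(c+1) lies strictly between t_c and t_(c+2) for every c: the map a ↦ t_a
-- is strictly monotone on ℤ, which is impossible in a well-order.

open import Defs
open import Data.Nat using (ℕ; _≤_; _*_)
open import Data.Product using (Σ; _×_)

open import Data.Nat as ℕ using (zero; suc; _+_; _<_; s≤s; z≤n)
import Data.Nat.Properties as ℕP
open import Data.Integer as ℤ using (ℤ; +_; -[1+_]; 1ℤ; -1ℤ) renaming (suc to sucℤ)
import Data.Integer.Properties as ℤP
open import Data.Fin as Fin using (Fin; inject₁; splitAt)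
import Data.Fin.Properties as FinP
open import Data.Product using (∃; _,_; proj₁; proj₂)
open import Data.Product.Properties using (≡-dec)
open import Data.Product.Relation.Binary.Pointwise.NonDependent using (≡×≡⇒≡)
open import Data.Product.Relation.Binary.Lex.Strict
  using (×-Lex; ×-transitive; ×-antisymmetric; ×-total₂)
open import Data.Sum as Sum using (_⊎_; inj₁; inj₂; reduce)
open import Data.Empty using (⊥-elim)
open import Data.Unit using (⊤; tt)
open import Data.List using (List; map; length; allFin; lookup)
open import Data.List.Properties using (length-map; length-tabulate)
open import Data.List.Membership.Propositional using (_∈_; _∉_)
open import Data.List.Membership.Propositional.Properties using (∈-map⁺; ∈-allFin)
import Data.List.Membership.DecPropositional as DecMembership
open import Data.List.Relation.Unary.Any using (index)
open import Data.List.Relation.Unary.Any.Properties using (lookup-index)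
open import Function using (_∘_)
open import Function.Bundles using (Injection)
open import Function.Definitions using (Injective)
open import Function.Properties.Inverse using (↔⇒↣)
open import Relation.Nullary using (¬_; yes; no)
open import Relation.Nullary.Decidable using (_⊎-dec_)
open import Relation.Binary.Definitions using (DecidableEquality; tri<; tri≈; tri>)
open import Relation.Binary.Structures using (IsTotalOrder)
open import Relation.Binary.PropositionalEquality
  using (_≡_; _≢_; refl; sym; trans; cong; subst; isEquivalence; resp₂; module ≡-Reasoning)
import Relation.Binary.Construct.NonStrictToStrict as NonStrictToStrict

module LineProperties (L : Line) where
  open Line L
  open IsTotalOrder isTotalOrder using (total; antisym; isPartialOrder)
    renaming (refl to ≤-refl; trans to ≤-trans)
  open NonStrictToStrict _≡_ _≤L_ using (<-irrefl; <-asym; <-trans) renaming (_<_ to _<L_)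

  Between : Carrier → Carrier → Carrier → Set
  Between x y z = (x ≤L y × y ≤L z) ⊎ (z ≤L y × y ≤L x)

  StrictlyBetween : Carrier → Carrier → Carrier → Set
  StrictlyBetween x y z = (x <L y × y <L z) ⊎ (z <L y × y <L x)

  between-left : ∀ x z → Between x x z
  between-left x z with total x z
  ... | inj₁ x≤z = inj₁ (≤-refl , x≤z)
  ... | inj₂ z≤x = inj₂ (z≤x , ≤-refl)

  between-right : ∀ x z → Between x z z
  between-right x z with total x z
  ... | inj₁ x≤z = inj₁ (x≤z , ≤-refl)
  ... | inj₂ z≤x = inj₂ (≤-refl , z≤x)

  median : ∀ x y z → Between y x z ⊎ Between x y z ⊎ Between x z y
  median x y z with total x y | total y z | total x z
  ... | inj₁ x≤y | inj₁ y≤z | _        = inj₂ (inj₁ (inj₁ (x≤y , y≤z)))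
  ... | inj₁ x≤y | inj₂ z≤y | inj₁ x≤z = inj₂ (inj₂ (inj₁ (x≤z , z≤y)))
  ... | inj₁ x≤y | inj₂ z≤y | inj₂ z≤x = inj₁ (inj₂ (z≤x , x≤y))
  ... | inj₂ y≤x | _        | inj₁ x≤z = inj₁ (inj₁ (y≤x , x≤z))
  ... | inj₂ y≤x | inj₁ y≤z | inj₂ z≤x = inj₂ (inj₂ (inj₂ (y≤z , z≤x)))
  ... | inj₂ y≤x | inj₂ z≤y | inj₂ _   = inj₂ (inj₁ (inj₂ (z≤y , y≤x)))

  between-split : ∀ {x y z} → Between x y z → ∀ e → Between x y e ⊎ Between e y z
  between-split {y = y} (inj₁ (x≤y , y≤z)) e with total y e
  ... | inj₁ y≤e = inj₁ (inj₁ (x≤y , y≤e))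
  ... | inj₂ e≤y = inj₂ (inj₁ (e≤y , y≤z))
  between-split {y = y} (inj₂ (z≤y , y≤x)) e with total y e
  ... | inj₁ y≤e = inj₂ (inj₂ (z≤y , y≤e))
  ... | inj₂ e≤y = inj₁ (inj₂ (e≤y , y≤x))

  middle-strictlyBetween : ∀ {x y z} → ¬ Between y x z → ¬ Between x z y →
                           StrictlyBetween x y z
  middle-strictlyBetween {x} {y} {z} ¬y-x-z ¬x-z-y with median x y z
  ... | inj₁ y-x-z                    = ⊥-elim (¬y-x-z y-x-z)
  ... | inj₂ (inj₂ x-z-y)             = ⊥-elim (¬x-z-y x-z-y)
  ... | inj₂ (inj₁ (inj₁ (x≤y , y≤z))) = inj₁ ((x≤y , x≢y) , (y≤z , y≢z))
    where
    x≢y : x ≢ y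
    x≢y refl = ¬y-x-z (between-left x z)
    y≢z : y ≢ z
    y≢z refl = ¬x-z-y (between-right x y)
  ... | inj₂ (inj₁ (inj₂ (z≤y , y≤x))) = inj₂ ((z≤y , z≢y) , (y≤x , y≢x))
    where
    y≢x : y ≢ x
    y≢x refl = ¬y-x-z (between-left y z)
    z≢y : z ≢ y
    z≢y refl = ¬x-z-y (between-right x z)

  Convex : (Carrier → Set) → Set
  Convex P = ∀ {x y z} → x ≤L y → y ≤L z → P x → P z → P y

  convex-between : ∀ {P} → Convex P → ∀ {x y z} → Between x y z → P x → P z → P y
  convex-between convex (inj₁ (x≤y , y≤z)) px pz = convex x≤y y≤z px pz
  convex-between convex (inj₂ (z≤y , y≤x)) px pz = convex z≤y y≤x pz px

  ∩-convex : ∀ {P Q} → Convex P → Convex Q → Convex (λ t → P t × Q t)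
  ∩-convex cP cQ x≤y y≤z (px , qx) (pz , qz) = cP x≤y y≤z px pz , cQ x≤y y≤z qx qz

  -- The witness is the median of the three pairwise witnesses.
  helly₃ : ∀ {A B C} → Convex A → Convex B → Convex C →
           ∃ (λ t → A t × B t) → ∃ (λ t → B t × C t) → ∃ (λ t → A t × C t) →
           ∃ λ t → A t × B t × C t
  helly₃ cA cB cC (x , ax , bx) (y , by , cy) (z , az , cz) with median x y z
  ... | inj₁ y-x-z        = x , ax , bx , convex-between cC y-x-z cy cz
  ... | inj₂ (inj₁ x-y-z) = y , convex-between cA x-y-z ax az , by , cy
  ... | inj₂ (inj₂ x-z-y) = z , az , convex-between cB x-z-y bx by , cz

  helly-within : ∀ {n} (A : Carrier → Set) (P : Fin n → Carrier → Set) →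
                 Convex A → (∀ i → Convex (P i)) → ∃ A →
                 (∀ i → ∃ λ t → A t × P i t) → (∀ i j → ∃ λ t → P i t × P j t) →
                 ∃ λ t → A t × ∀ i → P i t
  helly-within {zero} A P _ _ (t , a) _ _ = t , a , λ ()
  helly-within {suc n} A P cA cP _ meets pairwise
    with helly-within (λ t → A t × P Fin.zero t) (P ∘ Fin.suc)
           (∩-convex cA (cP Fin.zero)) (cP ∘ Fin.suc) (meets Fin.zero) meets₀
           (λ i j → pairwise (Fin.suc i) (Fin.suc j))
    where
    meets₀ : ∀ i → ∃ λ t → (A t × P Fin.zero t) × P (Fin.suc i) t
    meets₀ i with helly₃ cA (cP Fin.zero) (cP (Fin.suc i))
                    (meets Fin.zero) (pairwise Fin.zero (Fin.suc i)) (meets (Fin.suc i))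
    ... | t , a , p₀ , pᵢ = t , (a , p₀) , pᵢ
  ... | t , (a , p₀) , ps = t , a , λ { Fin.zero → p₀ ; (Fin.suc i) → ps i }

  helly : ∀ {n} (P : Fin n → Carrier → Set) → (∀ i → Convex (P i)) →
          (∀ i j → ∃ λ t → P i t × P j t) → ∃ λ t → ∀ i → P i t
  helly P cP pairwise
    with helly-within (λ _ → ⊤) P (λ _ _ _ _ → tt) cP (point , tt)
           (λ i → let (t , p) = pairwise i i in t , tt , proj₁ p) pairwise
  ... | t , _ , ps = t , ps

  descending⇒¬wellOrder : (f : ℕ → Carrier) → (∀ n → f (suc n) <L f n) → ¬ IsWellOrder L
  descending⇒¬wellOrder f desc wo = wo (f , injective , λ n → proj₁ (desc n))
    where
    later-smaller : ∀ {i j} → i < j → f j <L f i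
    later-smaller {i} {suc j} i<1+j with ℕP.m<1+n⇒m<n∨m≡n i<1+j
    ... | inj₁ i<j  = <-trans isPartialOrder (desc j) (later-smaller i<j)
    ... | inj₂ refl = desc i
    injective : Injective _≡_ _≡_ f
    injective {i} {j} fi≡fj with ℕP.<-cmp i j
    ... | tri< i<j _ _ = ⊥-elim (<-irrefl (sym fi≡fj) (later-smaller i<j))
    ... | tri≈ _ i≡j _ = i≡j
    ... | tri> _ _ j<i = ⊥-elim (<-irrefl fi≡fj (later-smaller j<i))

  chain-descending : (f : ℕ → Carrier) →
                     (∀ n → StrictlyBetween (f n) (f (suc n)) (f (suc (suc n)))) →
                     f 1 <L f 0 → ∀ n → f (suc n) <L f n
  chain-descending f chain f₁<f₀ zero = f₁<f₀
  chain-descending f chain f₁<f₀ (suc n) with chain n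
  ... | inj₁ (fₙ<fₙ₊₁ , _) = ⊥-elim (<-asym antisym fₙ<fₙ₊₁ (chain-descending f chain f₁<f₀ n))
  ... | inj₂ (fₙ₊₂<fₙ₊₁ , _) = fₙ₊₂<fₙ₊₁

  -- According to the order of p -1, p 0 and p 1, the chain descends along ℕ or along -ℕ.
  ℤ-chain⇒¬wellOrder : (p : ℤ → Carrier) →
                       (∀ c → StrictlyBetween (p c) (p (sucℤ c)) (p (sucℤ (sucℤ c)))) →
                       ¬ IsWellOrder L
  ℤ-chain⇒¬wellOrder p chain with chain -1ℤ
  ... | inj₁ (p₋₁<p₀ , _) =
    descending⇒¬wellOrder (p ∘ ℤ.-_ ∘ +_)
      (chain-descending (p ∘ ℤ.-_ ∘ +_) backward p₋₁<p₀)
    where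
    -- Splitting on n lets sucℤ compute on the negative indices.
    backward : ∀ n → StrictlyBetween (p (ℤ.- + n)) (p (ℤ.- + suc n)) (p (ℤ.- + suc (suc n)))
    backward zero    = Sum.swap (chain -[1+ 1 ])
    backward (suc n) = Sum.swap (chain -[1+ suc (suc n) ])
  ... | inj₂ (p₁<p₀ , _) =
    descending⇒¬wellOrder (p ∘ +_) (chain-descending (p ∘ +_) (chain ∘ +_) p₁<p₀)

  module _ (σ : Carrier → Carrier) (σ-mono : ∀ {x y} → x ≤L y → σ x ≤L σ y) where

    Window : Carrier → Carrier → Set
    Window t v = t ≤L v × ¬ (σ t ≤L v)

    window-interpolates : ∀ t t' t'' → t ≤L t' → t' ≤L t'' →
                          ∀ v → Window t v → Window t'' v → Window t' v
    window-interpolates t t' t'' t≤t' t'≤t'' v (_ , σt≰v) (t''≤v , _) =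
      ≤-trans t'≤t'' t''≤v , λ σt'≤v → σt≰v (≤-trans (σ-mono t≤t') σt'≤v)

module DecompositionProperties {G : Graph} (D : LineDecomposition G) where
  open Graph G
  open LineDecomposition D
  open LineProperties L

  bags-convex : ∀ v → Convex (λ t → W t v)
  bags-convex v {x} {y} {z} x≤y y≤z = interp x y z x≤y y≤z v

  edge-meets-between : ∀ {u v x y z} → E u v → W x u → W z v → Between x y z →
                       W y u ⊎ W y v
  edge-meets-between {u} {v} {x} {y} {z} uv xu zv x-y-z with ecover u v uv
  ... | e , eu , ev with between-split x-y-z e
  ...   | inj₁ x-y-e = inj₁ (convex-between (bags-convex u) x-y-e xu eu)
  ...   | inj₂ e-y-z = inj₂ (convex-between (bags-convex v) e-y-z ev zv)

  clique-in-bag : ∀ {n} (f : Fin n → V) → (∀ {i j} → i ≢ j → E (f i) (f j)) →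
                  ∃ λ t → ∀ i → W t (f i)
  clique-in-bag f clique = helly (λ i t → W t (f i)) (bags-convex ∘ f) pairwise
    where
    pairwise : ∀ i j → ∃ λ t → W t (f i) × W t (f j)
    pairwise i j with i FinP.≟ j
    ... | yes refl = let (t , w) = vcover (f i) in t , w , w
    ... | no i≢j   = ecover (f i) (f j) (clique i≢j)

injection-length : ∀ {A : Set} {n} (xs : List A) (f : Fin n → A) → Injective _≡_ _≡_ f →
                   (∀ i → f i ∈ xs) → n ≤ length xs
injection-length xs f f-injective f∈xs = FinP.injective⇒≤ index-injective
  where
  index-injective : Injective _≡_ _≡_ (index ∘ f∈xs)
  index-injective {i} {j} eq = f-injective (begin
    f i                        ≡⟨ lookup-index (f∈xs i) ⟩
    lookup xs (index (f∈xs i)) ≡⟨ cong (lookup xs) eq ⟩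
    lookup xs (index (f∈xs j)) ≡⟨ lookup-index (f∈xs j) ⟨
    f j                        ∎)
    where open ≡-Reasoning

module _ {A : Set} (_≟_ : DecidableEquality A) where
  open DecMembership _≟_ using (_∈?_)

  -- e enumerates n points and m pairs, all of them distinct.
  pair-outside : ∀ {n m} (xs : List A) → length xs < n + m →
                 (e : Fin n ⊎ Fin m ⊎ Fin m → A) → Injective _≡_ _≡_ e →
                 (∀ i → e (inj₁ i) ∈ xs) →
                 ∃ λ r → e (inj₂ (inj₁ r)) ∉ xs × e (inj₂ (inj₂ r)) ∉ xs
  pair-outside {n} {m} xs short e e-injective points∈xs
    with FinP.¬∀⟶∃¬ m Hit (λ r → (_ ∈? xs) ⊎-dec (_ ∈? xs)) ¬all-hit
    where
    Hit : Fin m → Set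
    Hit r = e (inj₂ (inj₁ r)) ∈ xs ⊎ e (inj₂ (inj₂ r)) ∈ xs
    ¬all-hit : ¬ (∀ r → Hit r)
    ¬all-hit hit = ℕP.<⇒≱ short (injection-length xs (e ∘ pick ∘ splitAt n) injective pick∈xs)
      where
      pick : Fin n ⊎ Fin m → Fin n ⊎ Fin m ⊎ Fin m
      pick (inj₁ i) = inj₁ i
      pick (inj₂ r) with hit r
      ... | inj₁ _ = inj₂ (inj₁ r)
      ... | inj₂ _ = inj₂ (inj₂ r)
      forget-pick : ∀ x → Sum.map₂ reduce (pick x) ≡ x
      forget-pick (inj₁ i) = refl
      forget-pick (inj₂ r) with hit r
      ... | inj₁ _ = refl
      ... | inj₂ _ = refl
      pick∈xs : ∀ i → e (pick (splitAt n i)) ∈ xs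
      pick∈xs i with splitAt n i
      ... | inj₁ j = points∈xs j
      ... | inj₂ r with hit r
      ...   | inj₁ hit₁ = hit₁
      ...   | inj₂ hit₂ = hit₂
      injective : Injective _≡_ _≡_ (e ∘ pick ∘ splitAt n)
      injective {i} {j} eq = Injection.injective (↔⇒↣ FinP.+↔⊎) (begin
        splitAt n i                          ≡⟨ forget-pick (splitAt n i) ⟨
        Sum.map₂ reduce (pick (splitAt n i)) ≡⟨ cong (Sum.map₂ reduce) (e-injective eq) ⟩
        Sum.map₂ reduce (pick (splitAt n j)) ≡⟨ forget-pick (splitAt n j) ⟩
        splitAt n j                          ∎)
        where open ≡-Reasoning
  ... | r , ¬hit = r , ¬hit ∘ inj₁ , ¬hit ∘ inj₂

i<suc[i] : ∀ {i} → i ℤ.< sucℤ i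
i<suc[i] = ℤP.suc[i]≤j⇒i<j ℤP.≤-refl

i≢suc[suc[i]] : ∀ {i} → i ≢ sucℤ (sucℤ i)
i≢suc[suc[i]] i≡2+i = ℤP.<-irrefl i≡2+i (ℤP.<-trans i<suc[i] i<suc[i])

module ChainOfCliques (k : ℕ) where

  Vertex : Set
  Vertex = ℤ × Fin (suc k)

  data Edge : Vertex → Vertex → Set where
    column  : ∀ a {x y} → x ≢ y → Edge (a , x) (a , y)
    rung    : ∀ a (r : Fin k) → Edge (a , Fin.suc r) (sucℤ a , inject₁ r)
    rung⁻¹  : ∀ a (r : Fin k) → Edge (sucℤ a , inject₁ r) (a , Fin.suc r)

  edge-sym : ∀ {u v} → Edge u v → Edge v u
  edge-sym (column a x≢y) = column a (x≢y ∘ sym)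
  edge-sym (rung a r)     = rung⁻¹ a r
  edge-sym (rung⁻¹ a r)   = rung a r

  edge-distinct : ∀ {u v} → Edge u v → u ≢ v
  edge-distinct (column a x≢y) = x≢y ∘ cong proj₂
  edge-distinct (rung a r)     = ℤP.i≢suc[i] ∘ cong proj₁
  edge-distinct (rung⁻¹ a r)   = ℤP.i≢suc[i] ∘ sym ∘ cong proj₁

  chainOfCliques : Graph
  chainOfCliques = record
    { V = Vertex ; E = Edge ; E-sym = edge-sym ; E-irr = λ e → edge-distinct e refl }

  _≤lex_ : Vertex → Vertex → Set
  _≤lex_ = ×-Lex _≡_ ℤ._<_ Fin._≤_

  ≤lex-isTotalOrder : IsTotalOrder _≡_ _≤lex_
  ≤lex-isTotalOrder = record
    { isPartialOrder = record
      { isPreorder = record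
        { isEquivalence = isEquivalence
        ; reflexive     = λ { refl → inj₂ (refl , FinP.≤-refl) }
        ; trans         = ×-transitive {_<₂_ = Fin._≤_}
                            isEquivalence (resp₂ ℤ._<_) ℤP.<-trans FinP.≤-trans
        }
      ; antisym = λ u≤v v≤u →
          ≡×≡⇒≡ (×-antisymmetric {_<₁_ = ℤ._<_} {_<₂_ = Fin._≤_}
                   sym ℤP.<-irrefl ℤP.<-asym FinP.≤-antisym u≤v v≤u)
      }
    ; total = ×-total₂ {_<₂_ = Fin._≤_} sym ℤP.<-cmp FinP.≤-total
    }

  lexLine : Line
  lexLine = record
    { Carrier = Vertex ; _≤L_ = _≤lex_ ; isTotalOrder = ≤lex-isTotalOrder
    ; point = + 0 , Fin.zero }

  shift : Vertex → Vertex
  shift (a , s) = sucℤ a , s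

  shift-mono : ∀ {u v} → u ≤lex v → shift u ≤lex shift v
  shift-mono (inj₁ a<b)          = inj₁ (ℤP.+-monoʳ-< 1ℤ a<b)
  shift-mono (inj₂ (refl , s≤r)) = inj₂ (refl , s≤r)

  open LineProperties lexLine using (Window; window-interpolates)

  Bag : Vertex → Vertex → Set
  Bag = Window shift shift-mono

  bag-column : ∀ a {s r} → s Fin.≤ r → Bag (a , s) (a , r)
  bag-column a s≤r = inj₂ (refl , s≤r) , λ
    { (inj₁ 1+a<a)        → ℤP.<-irrefl refl (ℤP.suc[i]≤j⇒i<j (ℤP.<⇒≤ 1+a<a))
    ; (inj₂ (1+a≡a , _)) → ℤP.i≢suc[i] (sym 1+a≡a) }

  bag-next-column : ∀ a {s r} → r Fin.< s → Bag (a , s) (sucℤ a , r)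
  bag-next-column a r<s = inj₁ i<suc[i] , λ
    { (inj₁ 1+a<1+a)     → ℤP.<-irrefl refl 1+a<1+a
    ; (inj₂ (_ , s≤r))  → ℕP.<⇒≱ r<s s≤r }

  bag-cover : ∀ u v → Edge u v → ∃ λ t → Bag t u × Bag t v
  bag-cover _ _ (column a _) = (a , Fin.zero) , bag-column a z≤n , bag-column a z≤n
  bag-cover _ _ (rung a r)   =
    (a , Fin.suc r) , bag-column a FinP.≤-refl , bag-next-column a (FinP.≤̄⇒inject₁< FinP.≤-refl)
  bag-cover _ _ (rung⁻¹ a r) =
    (a , Fin.suc r) , bag-next-column a (FinP.≤̄⇒inject₁< FinP.≤-refl) , bag-column a FinP.≤-refl

  windowDecomposition : LineDecomposition chainOfCliques
  windowDecomposition = record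
    { L      = lexLine
    ; W      = Bag
    ; vcover = λ { (a , r) → (a , r) , bag-column a FinP.≤-refl }
    ; ecover = bag-cover
    ; interp = window-interpolates shift shift-mono
    }

  bagEntry : ℤ → Fin (suc k) → Fin (suc k) → Vertex
  bagEntry a s r with s Fin.≤? r
  ... | yes _ = a , r
  ... | no _  = sucℤ a , r

  bagEntry-exhaustive : ∀ {a s b r} → Bag (a , s) (b , r) → bagEntry a s r ≡ (b , r)
  bagEntry-exhaustive {a} {s} {r = r} (inj₂ (refl , s≤r) , _) with s Fin.≤? r
  ... | yes _   = refl
  ... | no s≰r  = ⊥-elim (s≰r s≤r)
  bagEntry-exhaustive {a} {s} {b} {r} (inj₁ a<b , 1+a≰b) with sucℤ a ℤ.≟ b | s Fin.≤? r
  ... | no 1+a≢b | _     = ⊥-elim (1+a≰b (inj₁ (ℤP.≤∧≢⇒< (ℤP.i<j⇒suc[i]≤j a<b) 1+a≢b)))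
  ... | yes refl | yes s≤r = ⊥-elim (1+a≰b (inj₂ (refl , s≤r)))
  ... | yes refl | no _    = refl

  windowDecomposition-width : WidthAtMost windowDecomposition k
  windowDecomposition-width (a , s) = map (bagEntry a s) (allFin (suc k)) , length≤ , covers
    where
    length≤ : length (map (bagEntry a s) (allFin (suc k))) ≤ suc k
    length≤ = ℕP.≤-reflexive (trans (length-map (bagEntry a s) (allFin (suc k)))
                                    (length-tabulate (λ r → r)))
    covers : ∀ v → Bag (a , s) v → v ∈ map (bagEntry a s) (allFin (suc k))
    covers (b , r) v∈bag =
      subst (_∈ _) (bagEntry-exhaustive v∈bag) (∈-map⁺ (bagEntry a s) (∈-allFin r))

  module _ (D : LineDecomposition chainOfCliques) (bags : BagsAtMost D (2 * k)) where
    open LineDecomposition D using (L; W)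
    open LineProperties L
      using (Between; StrictlyBetween; middle-strictlyBetween; ℤ-chain⇒¬wellOrder)
    open DecompositionProperties D using (edge-meets-between; clique-in-bag)

    -- A bag holding the whole column b has room for at most k - 1 further
    -- vertices, so it misses one of the k disjoint rungs between c and c+1.
    bag-misses-rung : ∀ {t b c} → (∀ r → W t (b , r)) → b ≢ c → b ≢ sucℤ c →
                      ∃ λ r → ¬ W t (c , Fin.suc r) × ¬ W t (sucℤ c , inject₁ r)
    bag-misses-rung {t} {b} {c} column⊆t b≢c b≢1+c with bags t
    ... | xs , length≤ , covers
      with pair-outside (≡-dec ℤ._≟_ FinP._≟_) xs short e e-injective
             (λ r → covers _ (column⊆t r))
      where
      short : length xs < suc k + k
      short = s≤s (ℕP.≤-trans length≤ (ℕP.≤-reflexive (cong (k ℕ.+_) (ℕP.+-identityʳ k))))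
      e : Fin (suc k) ⊎ Fin k ⊎ Fin k → Vertex
      e (inj₁ r)        = b , r
      e (inj₂ (inj₁ r)) = c , Fin.suc r
      e (inj₂ (inj₂ r)) = sucℤ c , inject₁ r
      e-injective : Injective _≡_ _≡_ e
      e-injective {inj₁ _}        {inj₁ _}        eq = cong inj₁ (cong proj₂ eq)
      e-injective {inj₂ (inj₁ _)} {inj₂ (inj₁ _)} eq =
        cong (inj₂ ∘ inj₁) (FinP.suc-injective (cong proj₂ eq))
      e-injective {inj₂ (inj₂ _)} {inj₂ (inj₂ _)} eq =
        cong (inj₂ ∘ inj₂) (FinP.inject₁-injective (cong proj₂ eq))
      e-injective {inj₁ _}        {inj₂ (inj₁ _)} eq = ⊥-elim (b≢c (cong proj₁ eq))
      e-injective {inj₁ _}        {inj₂ (inj₂ _)} eq = ⊥-elim (b≢1+c (cong proj₁ eq))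
      e-injective {inj₂ (inj₁ _)} {inj₁ _}        eq = ⊥-elim (b≢c (sym (cong proj₁ eq)))
      e-injective {inj₂ (inj₂ _)} {inj₁ _}        eq = ⊥-elim (b≢1+c (sym (cong proj₁ eq)))
      e-injective {inj₂ (inj₁ _)} {inj₂ (inj₂ _)} eq = ⊥-elim (ℤP.i≢suc[i] (cong proj₁ eq))
      e-injective {inj₂ (inj₂ _)} {inj₂ (inj₁ _)} eq =
        ⊥-elim (ℤP.i≢suc[i] (sym (cong proj₁ eq)))
    ... | r , u∉xs , v∉xs = r , u∉xs ∘ covers _ , v∉xs ∘ covers _

    module _ (columnBag : ℤ → Line.Carrier L)
             (columnBag-column : ∀ a r → W (columnBag a) (a , r)) where

      columnBag-not-between : ∀ {b c} → b ≢ c → b ≢ sucℤ c →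
                              ¬ Between (columnBag c) (columnBag b) (columnBag (sucℤ c))
      columnBag-not-between {b} {c} b≢c b≢1+c between
        with bag-misses-rung (columnBag-column b) b≢c b≢1+c
      ... | r , u∉bag , v∉bag =
        Sum.[ u∉bag , v∉bag ] (edge-meets-between (rung c r)
          (columnBag-column c (Fin.suc r)) (columnBag-column (sucℤ c) (inject₁ r)) between)

      columnBags-chain : ∀ c → StrictlyBetween (columnBag c) (columnBag (sucℤ c))
                                               (columnBag (sucℤ (sucℤ c)))
      columnBags-chain c = middle-strictlyBetween
        (columnBag-not-between ℤP.i≢suc[i] i≢suc[suc[i]])
        (columnBag-not-between (i≢suc[suc[i]] ∘ sym) (ℤP.i≢suc[i] ∘ sym))

    ¬wellOrder : ¬ IsWellOrder L
    ¬wellOrder = ℤ-chain⇒¬wellOrder (proj₁ ∘ column-in-bag)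
                   (columnBags-chain (proj₁ ∘ column-in-bag) (proj₂ ∘ column-in-bag))
      where
      column-in-bag : ∀ a → ∃ λ t → ∀ r → W t (a , r)
      column-in-bag a = clique-in-bag (a ,_) (column a)

-- The construction works for every k.
mainTheorem2 : (k : ℕ) → 1 ≤ k →
    Σ Graph λ G → LineWidthAtMost G k × WoWidthAtLeast G (2 * k)
mainTheorem2 k _ =
  chainOfCliques , (windowDecomposition , windowDecomposition-width) ,
  λ D wellOrdered bags → ¬wellOrder D bags wellOrdered
  where open ChainOfCliques k
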